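{- Let $G$ be a recursively partitionable graph of order $n$. If $G$ has a vertex cut $S$ with $|S|=2$ and $c(G-S)=5$, then $n\geq 11$.
   Context: $c(H)$ is the number of components of $H$. A graph $G$ on $n$ vertices is recursively partitionable (RP) if $G\simeq K_1$, or $G$ is connected and for every integer partition $a_1,\dots,a_m$ of $n$ there is a partition $\{A_1,\dots,A_m\}$ of $V(G)$ with $|A_i|=a_i$ such that each induced subgraph $G[A_i]$ is RP. -}

module Defs where

open import Data.Nat using (ℕ; zero; suc; _≤_)
open import Data.Fin using (Fin)
open import Data.Fin.Subset using (Subset; _∈_; _⊆_; ∣_∣; ⊤; ∁; Nonempty)
open import Data.Vec using (Vec; lookup; sum)
open import Data.Product using (Σ; ∃; _×_; _,_)
open import Data.Empty using (⊥)
open import Relation.Binary.PropositionalEquality using (_≡_; _≢_)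
open import Relation.Nullary using (¬_)

record Graph (n : ℕ) : Set₁ where
  field
    Adj    : Fin n → Fin n → Set
    sym    : ∀ {u v} → Adj u v → Adj v u
    irrefl : ∀ {u} → ¬ Adj u u
open Graph public

module _ {n : ℕ} (G : Graph n) where

  data WalkIn (A : Subset n) : Fin n → Fin n → Set where
    here : ∀ {u} → u ∈ A → WalkIn A u u
    step : ∀ {u w v} → u ∈ A → Adj G u w → WalkIn A w v → WalkIn A u v

  ConnectedIn : Subset n → Set
  ConnectedIn A = ∀ {u v} → u ∈ A → v ∈ A → WalkIn A u v

  IsPartitionOf : (A : Subset n) (m : ℕ) → (Fin m → Subset n) → Set
  IsPartitionOf A m P =
      (∀ i → P i ⊆ A)
    × (∀ i j {v} → i ≢ j → v ∈ P i → v ∈ P j → ⊥)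
    × (∀ {v} → v ∈ A → ∃ λ i → v ∈ P i)

  -- Recursively partitionable: RP A means the induced subgraph G[A] is RP.
  -- G[A] ≅ K₁, or G[A] is connected and for every integer partition
  -- a₁,…,a_m of |A| (with m ≥ 2; the case m = 1 is the trivial partition {A})
  -- there is a partition A₁,…,A_m of A with |A_i| = a_i and each G[A_i] RP.
  data RP : Subset n → Set where
    rp-K1  : ∀ {A} → ∣ A ∣ ≡ 1 → RP A
    rp-rec : ∀ {A} → Nonempty A → ConnectedIn A →
             (∀ (m : ℕ) → 2 ≤ m → (a : Vec ℕ m) → (∀ i → 1 ≤ lookup a i) →
                sum a ≡ ∣ A ∣ →
                ∃ λ (P : Fin m → Subset n) →
                  IsPartitionOf A m P × (∀ i → ∣ P i ∣ ≡ lookup a i) × (∀ i → RP (P i))) →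
             RP A

  NumComponents : Subset n → ℕ → Set
  NumComponents B k =
    ∃ λ (P : Fin k → Subset n) →
        IsPartitionOf B k P
      × (∀ i → Nonempty (P i))
      × (∀ i → ConnectedIn (P i))
      × (∀ i j {u v} → i ≢ j → u ∈ P i → v ∈ P j → ¬ Adj G u v)

IsRP : ∀ {n} → Graph n → Set
IsRP G = RP G ⊤

{-# OPTIONS --safe #-}
module Submission where

-- Let Q₁, …, Q₅ be the components of G − S. A connected set avoiding S lies inside one
-- component, so an RP part larger than every component meets S; a vertex forming a singleton
-- component has all its neighbours in S, so an RP part of size 2 containing it meets S, and
-- contains no other such vertex. Since |S| = 2, no three disjoint parts can meet S.
-- If n ≤ 10, the sizes of the Qᵢ sum to n − 2 ≤ 8, which leaves two cases: either every
-- component has at most 2 vertices and n ≥ 9, and a partition of sizes 3, 3, n − 6 fails; or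
-- there are enough singleton components (three if n = 10, four otherwise) for a partition into
-- parts of size 2 and at most one part of size 1 to fail.

open import Defs hiding (sym)
open import Data.Nat using (ℕ; zero; suc; _+_; _*_; _∸_; _/_; _%_; _≤_; _<_; _≤?_; z≤n; s≤s)
open import Data.Nat.Properties
  using (_≟_; ≤-refl; ≤-trans; ≤-reflexive; ≤-pred; <-≤-trans; ≤∧≢⇒<; ≮⇒≥; ≰⇒>; 1+n≰n;
         +-suc; +-assoc; +-identityʳ; +-monoˡ-≤; +-monoʳ-≤; +-cancelˡ-≤; m≤n+m; m≤m+n;
         m+[n∸m]≡n; ∸-monoˡ-≤; module ≤-Reasoning)
open import Data.Nat.DivMod using (m≡m%n+[m/n]*n; m%n<n; /-monoˡ-≤)
open import Data.Nat.ListAction using (sum)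
open import Data.Fin as Fin using (Fin; zero; suc)
open import Data.Fin.Properties using (any?; all?; ¬∀⟶∃¬)
open import Data.Fin.Subset
  using (Subset; _∈_; _∉_; _⊆_; ∣_∣; ⊤; ∁; Nonempty; _∪_; ⁅_⁆; ⋃; inside; outside)
open import Data.Fin.Subset.Properties
  using (_∈?_; x∈p⇒∣p-x∣<∣p∣; x∈p∧x≢y⇒x∈p-y; p⊆q⇒∣p∣≤∣q∣; ∣⊥∣≡0; ∉⊥; ∣⁅x⁆∣≡1; x∈⁅x⁆; x∈p∪q⁻;
         x∈∁p⇒x∉p; x∉p⇒x∈∁p; ∣∁p∣≡n∸∣p∣; ∣p∣≤n; ∈⊤; ∣⊤∣≡n)
open import Data.List using (List; []; _∷_; length; map; filter; allFin)
open import Data.List.Membership.Propositional using (lose) renaming (_∈_ to _∈ₗ_)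
open import Data.List.Membership.Propositional.Properties using (∈-allFin)
open import Data.List.Properties using (filter-some)
open import Data.List.Relation.Unary.All as All using (All; []; _∷_)
open import Data.List.Relation.Unary.All.Properties using (all-filter)
open import Data.List.Relation.Unary.Any using (here; there)
open import Data.List.Relation.Unary.Unique.Propositional using (Unique; []; _∷_)
open import Data.List.Relation.Unary.Unique.Propositional.Properties using (allFin⁺; filter⁺)
open import Data.Vec as Vec using (Vec; []; _∷_; lookup; replicate; here; there)
open import Data.Vec.Properties using (lookup-replicate)
open import Data.Product using (∃; _×_; _,_; proj₁; proj₂)
open import Data.Sum using (inj₁; inj₂)
open import Data.Empty using (⊥; ⊥-elim)
open import Relation.Binary.PropositionalEquality
  using (_≡_; _≢_; refl; sym; trans; cong; subst; ≢-sym; module ≡-Reasoning)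
open import Relation.Nullary using (¬_; Dec; yes; no; contradiction)
open import Relation.Nullary.Decidable using (_×-dec_; ¬?)

private
  variable
    n m : ℕ
    p : Subset n
    x y z : Fin n

x∈p⇒0<∣p∣ : x ∈ p → 0 < ∣ p ∣
x∈p⇒0<∣p∣ x∈p = <-≤-trans (s≤s z≤n) (x∈p⇒∣p-x∣<∣p∣ x∈p)

distinct₂⇒2≤∣p∣ : x ∈ p → y ∈ p → x ≢ y → 2 ≤ ∣ p ∣
distinct₂⇒2≤∣p∣ x∈p y∈p x≢y =
  <-≤-trans (s≤s (x∈p⇒0<∣p∣ (x∈p∧x≢y⇒x∈p-y y∈p (≢-sym x≢y)))) (x∈p⇒∣p-x∣<∣p∣ x∈p)

distinct₃⇒3≤∣p∣ : x ∈ p → y ∈ p → z ∈ p → x ≢ y → x ≢ z → y ≢ z → 3 ≤ ∣ p ∣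
distinct₃⇒3≤∣p∣ x∈p y∈p z∈p x≢y x≢z y≢z =
  <-≤-trans (s≤s (distinct₂⇒2≤∣p∣ (x∈p∧x≢y⇒x∈p-y y∈p (≢-sym x≢y))
                                  (x∈p∧x≢y⇒x∈p-y z∈p (≢-sym x≢z)) y≢z))
            (x∈p⇒∣p-x∣<∣p∣ x∈p)

∣p∣≤1⇒x≡y : ∣ p ∣ ≤ 1 → x ∈ p → y ∈ p → x ≡ y
∣p∣≤1⇒x≡y {x = x} {y} ∣p∣≤1 x∈p y∈p with x Fin.≟ y
... | yes x≡y = x≡y
... | no  x≢y = contradiction (≤-trans (distinct₂⇒2≤∣p∣ x∈p y∈p x≢y) ∣p∣≤1) 1+n≰n

0<∣p∣⇒Nonempty : 0 < ∣ p ∣ → Nonempty p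
0<∣p∣⇒Nonempty {p = inside  ∷ p} _ = zero , here
0<∣p∣⇒Nonempty {p = outside ∷ p} 0<∣p∣ with 0<∣p∣⇒Nonempty {p = p} 0<∣p∣
... | x , x∈p = suc x , there x∈p

2≤∣p∣⇒∃≢ : 2 ≤ ∣ p ∣ → ∃ λ y → y ∈ p × y ≢ x
2≤∣p∣⇒∃≢ {p = p} {x = x} 2≤∣p∣ with any? (λ y → y ∈? p ×-dec ¬? (y Fin.≟ x))
... | yes found = found
... | no  none  = contradiction (≤-trans 2≤∣p∣ (subst (∣ p ∣ ≤_) (∣⁅x⁆∣≡1 x) (p⊆q⇒∣p∣≤∣q∣ p⊆⁅x⁆))) 1+n≰n
  where
  p⊆⁅x⁆ : p ⊆ ⁅ x ⁆
  p⊆⁅x⁆ {y} y∈p with y Fin.≟ x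
  ... | yes refl = x∈⁅x⁆ x
  ... | no  y≢x  = contradiction (y , y∈p , y≢x) none

Meets : Subset n → Subset n → Set
Meets A S = ∃ λ s → s ∈ A × s ∈ S

∣p∪q∣≡∣p∣+∣q∣ : ∀ (p q : Subset n) → (∀ {x} → x ∈ p → x ∈ q → ⊥) → ∣ p ∪ q ∣ ≡ ∣ p ∣ + ∣ q ∣
∣p∪q∣≡∣p∣+∣q∣ []            []            _        = refl
∣p∪q∣≡∣p∣+∣q∣ (inside  ∷ p) (inside  ∷ q) disjoint = ⊥-elim (disjoint here here)
∣p∪q∣≡∣p∣+∣q∣ (inside  ∷ p) (outside ∷ q) disjoint =
  cong suc (∣p∪q∣≡∣p∣+∣q∣ p q (λ x∈p x∈q → disjoint (there x∈p) (there x∈q)))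
∣p∪q∣≡∣p∣+∣q∣ (outside ∷ p) (inside  ∷ q) disjoint =
  trans (cong suc (∣p∪q∣≡∣p∣+∣q∣ p q (λ x∈p x∈q → disjoint (there x∈p) (there x∈q))))
        (sym (+-suc ∣ p ∣ ∣ q ∣))
∣p∪q∣≡∣p∣+∣q∣ (outside ∷ p) (outside ∷ q) disjoint =
  ∣p∪q∣≡∣p∣+∣q∣ p q (λ x∈p x∈q → disjoint (there x∈p) (there x∈q))

module _ {I : Set} (P : I → Subset n) where

  ∈⋃⁻ : ∀ is → x ∈ ⋃ (map P is) → ∃ λ i → i ∈ₗ is × x ∈ P i
  ∈⋃⁻ []       x∈∅ = ⊥-elim (∉⊥ x∈∅)
  ∈⋃⁻ (i ∷ is) x∈⋃ with x∈p∪q⁻ (P i) (⋃ (map P is)) x∈⋃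
  ... | inj₁ x∈Pi = i , here refl , x∈Pi
  ... | inj₂ x∈⋃′ with ∈⋃⁻ is x∈⋃′
  ...   | j , j∈is , x∈Pj = j , there j∈is , x∈Pj

  ⋃⊆ : ∀ {A} → (∀ i → P i ⊆ A) → ∀ is → ⋃ (map P is) ⊆ A
  ⋃⊆ P⊆A is x∈⋃ with ∈⋃⁻ is x∈⋃
  ... | i , _ , x∈Pi = P⊆A i x∈Pi

  ∣⋃∣≡sum : (∀ {i j x} → i ≢ j → x ∈ P i → x ∈ P j → ⊥) →
            ∀ {is} → Unique is → ∣ ⋃ (map P is) ∣ ≡ sum (map (λ i → ∣ P i ∣) is)
  ∣⋃∣≡sum disjoint {[]}     []               = ∣⊥∣≡0 n
  ∣⋃∣≡sum disjoint {i ∷ is} (i∉is ∷ unique) =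
    trans (∣p∪q∣≡∣p∣+∣q∣ (P i) (⋃ (map P is)) apart) (cong (∣ P i ∣ +_) (∣⋃∣≡sum disjoint unique))
    where
    apart : x ∈ P i → x ∈ ⋃ (map P is) → ⊥
    apart x∈Pi x∈⋃ with ∈⋃⁻ is x∈⋃
    ... | j , j∈is , x∈Pj = disjoint (All.lookup i∉is j∈is) x∈Pi x∈Pj

-- termwise: 2 + [c x ≥ 3] ≤ c x + [c x ≡ 1]
sum-bound : ∀ {A : Set} (c : A → ℕ) → (∀ x → 1 ≤ c x) → ∀ xs →
            length xs * 2 + length (filter (λ x → 3 ≤? c x) xs)
              ≤ sum (map c xs) + length (filter (λ x → c x ≟ 1) xs)
sum-bound c c≥1 []       = z≤n
sum-bound c c≥1 (x ∷ xs) with c x | c≥1 x | sum-bound c c≥1 xs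
... | 1                 | _ | ih = ≤-trans (s≤s (s≤s ih)) (≤-reflexive (sym (cong suc (+-suc _ _))))
... | 2                 | _ | ih = s≤s (s≤s ih)
... | suc (suc (suc v)) | _ | ih =
  s≤s (s≤s (≤-trans (≤-reflexive (+-suc _ _)) (s≤s (≤-trans ih (+-monoˡ-≤ _ (m≤n+m _ v))))))

sum-replicate : ∀ k x → Vec.sum (replicate k x) ≡ k * x
sum-replicate zero    x = refl
sum-replicate (suc k) x = cong (x +_) (sum-replicate k x)

m+k≤n+t⇒k≤t : ∀ {m k n t} → m + k ≤ n + t → n ≤ m → k ≤ t
m+k≤n+t⇒k≤t {m} {k} {n} {t} m+k≤n+t n≤m = +-cancelˡ-≤ m k t (≤-trans m+k≤n+t (+-monoˡ-≤ t n≤m))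

near-pairing : ∀ n → Vec ℕ (suc ((n ∸ 1) / 2))
near-pairing n = suc ((n ∸ 1) % 2) ∷ replicate ((n ∸ 1) / 2) 2

near-pairing-sum : 1 ≤ n → Vec.sum (near-pairing n) ≡ n
near-pairing-sum {n} 1≤n = begin
  suc r + Vec.sum (replicate k 2) ≡⟨ cong (suc r +_) (sum-replicate k 2) ⟩
  suc (r + k * 2)                 ≡⟨ cong suc (sym (m≡m%n+[m/n]*n (n ∸ 1) 2)) ⟩
  suc (n ∸ 1)                     ≡⟨ m+[n∸m]≡n 1≤n ⟩
  n                               ∎
  where
  open ≡-Reasoning
  r = (n ∸ 1) % 2
  k = (n ∸ 1) / 2

near-pairing-≡2 : ∀ n i → i ≢ zero → lookup (near-pairing n) i ≡ 2
near-pairing-≡2 n zero    i≢0 = contradiction refl i≢0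
near-pairing-≡2 n (suc i) _   = lookup-replicate i 2

near-pairing-≤2 : ∀ n i → lookup (near-pairing n) i ≤ 2
near-pairing-≤2 n zero    = m%n<n (n ∸ 1) 2
near-pairing-≤2 n (suc i) = ≤-reflexive (near-pairing-≡2 n (suc i) (λ ()))

near-pairing-positive : ∀ n i → 1 ≤ lookup (near-pairing n) i
near-pairing-positive n zero    = s≤s z≤n
near-pairing-positive n (suc i) = ≤-trans (s≤s z≤n) (≤-reflexive (sym (near-pairing-≡2 n (suc i) (λ ()))))

near-pairing-length : 3 ≤ n → 2 ≤ suc ((n ∸ 1) / 2)
near-pairing-length 3≤n = s≤s (/-monoˡ-≤ 2 (∸-monoˡ-≤ 1 3≤n))

module _ (G : Graph n) where

  private
    variable
      A S : Subset n
      u v w : Fin n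

  WalkIn-start : WalkIn G A u v → u ∈ A
  WalkIn-start (here u∈A)     = u∈A
  WalkIn-start (step u∈A _ _) = u∈A

  RP⇒ConnectedIn : RP G A → 2 ≤ ∣ A ∣ → ConnectedIn G A
  RP⇒ConnectedIn (rp-K1 ∣A∣≡1)        2≤∣A∣ = contradiction (subst (2 ≤_) ∣A∣≡1 2≤∣A∣) 1+n≰n
  RP⇒ConnectedIn (rp-rec _ connected _) _     = connected

  ConnectedIn⇒neighbour : ConnectedIn G A → 2 ≤ ∣ A ∣ → u ∈ A → ∃ λ w → w ∈ A × Adj G u w
  ConnectedIn⇒neighbour {u = u} connected 2≤∣A∣ u∈A with 2≤∣p∣⇒∃≢ {x = u} 2≤∣A∣
  ... | v , v∈A , v≢u with connected u∈A v∈A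
  ...   | here _               = contradiction refl v≢u
  ...   | step _ u~w walk-w-v = _ , WalkIn-start walk-w-v , u~w

  IsolatedIn∁ : Subset n → Fin n → Set
  IsolatedIn∁ S u = u ∉ S × (∀ {w} → Adj G u w → w ∈ S)

  isolated⇒Meets : RP G A → 2 ≤ ∣ A ∣ → u ∈ A → IsolatedIn∁ S u → Meets A S
  isolated⇒Meets rp 2≤∣A∣ u∈A (_ , N[u]⊆S) with ConnectedIn⇒neighbour (RP⇒ConnectedIn rp 2≤∣A∣) 2≤∣A∣ u∈A
  ... | w , w∈A , u~w = w , w∈A , N[u]⊆S u~w

  two-isolated⇒3≤∣A∣ : RP G A → u ∈ A → v ∈ A → u ≢ v → IsolatedIn∁ S u → IsolatedIn∁ S v → 3 ≤ ∣ A ∣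
  two-isolated⇒3≤∣A∣ rp u∈A v∈A u≢v iu@(u∉S , _) (v∉S , _)
    with isolated⇒Meets rp (distinct₂⇒2≤∣p∣ u∈A v∈A u≢v) u∈A iu
  ... | s , s∈A , s∈S =
    distinct₃⇒3≤∣p∣ u∈A v∈A s∈A u≢v (λ { refl → u∉S s∈S }) (λ { refl → v∉S s∈S })

  record RPPartition (a : Vec ℕ m) : Set where
    field
      part        : Fin m → Subset n
      partitions  : IsPartitionOf G ⊤ m part
      ∣part∣≡     : ∀ i → ∣ part i ∣ ≡ lookup a i
      RP-part     : ∀ i → RP G (part i)

    index : Fin n → Fin m
    index x = proj₁ (proj₂ (proj₂ partitions) (∈⊤ {x = x}))

    ∈part-index : ∀ x → x ∈ part (index x)
    ∈part-index x = proj₂ (proj₂ (proj₂ partitions) (∈⊤ {x = x}))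

    disjoint : ∀ {i j} → i ≢ j → x ∈ part i → x ∈ part j → ⊥
    disjoint i≢j = proj₁ (proj₂ partitions) _ _ i≢j

    three-Meets⇒3≤∣S∣ : ∀ {i j k} → i ≢ j → i ≢ k → j ≢ k →
                        Meets (part i) S → Meets (part j) S → Meets (part k) S → 3 ≤ ∣ S ∣
    three-Meets⇒3≤∣S∣ i≢j i≢k j≢k (s , s∈i , s∈S) (t , t∈j , t∈S) (r , r∈k , r∈S) =
      distinct₃⇒3≤∣p∣ s∈S t∈S r∈S (apart i≢j s∈i t∈j) (apart i≢k s∈i r∈k) (apart j≢k t∈j r∈k)
      where
      apart : ∀ {i j} → i ≢ j → x ∈ part i → y ∈ part j → x ≢ y
      apart i≢j x∈i y∈j refl = disjoint i≢j x∈i y∈j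

    index-injective : ∣ part (index u) ∣ ≤ 2 → IsolatedIn∁ S u → IsolatedIn∁ S v → u ≢ v →
                      index u ≢ index v
    index-injective {u = u} {v = v} ∣part∣≤2 iu iv u≢v index≡ =
      contradiction (≤-trans 3≤∣part∣ ∣part∣≤2) 1+n≰n
      where
      v∈part : v ∈ part (index u)
      v∈part = subst (λ i → v ∈ part i) (sym index≡) (∈part-index v)

      3≤∣part∣ : 3 ≤ ∣ part (index u) ∣
      3≤∣part∣ = two-isolated⇒3≤∣A∣ (RP-part (index u)) (∈part-index u) v∈part u≢v iu iv

    three-isolated-in-pairs⇒3≤∣S∣ : u ≢ v → u ≢ w → v ≢ w →
      IsolatedIn∁ S u → IsolatedIn∁ S v → IsolatedIn∁ S w →
      ∣ part (index u) ∣ ≡ 2 → ∣ part (index v) ∣ ≡ 2 → ∣ part (index w) ∣ ≡ 2 → 3 ≤ ∣ S ∣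
    three-isolated-in-pairs⇒3≤∣S∣ {u} {v} {w} u≢v u≢w v≢w iu iv iw ∣u∣≡2 ∣v∣≡2 ∣w∣≡2 =
      three-Meets⇒3≤∣S∣
        (index-injective (≤-reflexive ∣u∣≡2) iu iv u≢v)
        (index-injective (≤-reflexive ∣u∣≡2) iu iw u≢w)
        (index-injective (≤-reflexive ∣v∣≡2) iv iw v≢w)
        (isolated⇒Meets (RP-part _) (≤-reflexive (sym ∣u∣≡2)) (∈part-index u) iu)
        (isolated⇒Meets (RP-part _) (≤-reflexive (sym ∣v∣≡2)) (∈part-index v) iv)
        (isolated⇒Meets (RP-part _) (≤-reflexive (sym ∣w∣≡2)) (∈part-index w) iw)

    -- the four vertices lie in distinct parts, so at most one of them lies in the exceptional part i₀
    four-isolated⇒3≤∣S∣ : ∀ {i₀ u₁ u₂ u₃ u₄} →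
      (∀ i → ∣ part i ∣ ≤ 2) → (∀ i → i ≢ i₀ → ∣ part i ∣ ≡ 2) →
      u₁ ≢ u₂ → u₁ ≢ u₃ → u₁ ≢ u₄ → u₂ ≢ u₃ → u₂ ≢ u₄ → u₃ ≢ u₄ →
      IsolatedIn∁ S u₁ → IsolatedIn∁ S u₂ → IsolatedIn∁ S u₃ → IsolatedIn∁ S u₄ → 3 ≤ ∣ S ∣
    four-isolated⇒3≤∣S∣ {S = S} {i₀} {u₁} {u₂} {u₃} ∣part∣≤2 pair d₁₂ d₁₃ d₁₄ d₂₃ d₂₄ d₃₄ i₁ i₂ i₃ i₄ =
      cases (index u₁ Fin.≟ i₀) (index u₂ Fin.≟ i₀) (index u₃ Fin.≟ i₀)
      where
      beside : ∀ {u v} → index u ≡ i₀ → IsolatedIn∁ S u → IsolatedIn∁ S v → u ≢ v →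
               ∣ part (index v) ∣ ≡ 2
      beside e iu iv u≢v = pair _ (λ e′ → index-injective (∣part∣≤2 _) iu iv u≢v (trans e (sym e′)))

      cases : Dec (index u₁ ≡ i₀) → Dec (index u₂ ≡ i₀) → Dec (index u₃ ≡ i₀) → 3 ≤ ∣ S ∣
      cases (yes e₁) _ _ =
        three-isolated-in-pairs⇒3≤∣S∣ d₂₃ d₂₄ d₃₄ i₂ i₃ i₄
          (beside e₁ i₁ i₂ d₁₂) (beside e₁ i₁ i₃ d₁₃) (beside e₁ i₁ i₄ d₁₄)
      cases (no n₁) (yes e₂) _ =
        three-isolated-in-pairs⇒3≤∣S∣ d₁₃ d₁₄ d₃₄ i₁ i₃ i₄
          (pair _ n₁) (beside e₂ i₂ i₃ d₂₃) (beside e₂ i₂ i₄ d₂₄)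
      cases (no n₁) (no n₂) (yes e₃) =
        three-isolated-in-pairs⇒3≤∣S∣ d₁₂ d₁₄ d₂₄ i₁ i₂ i₄
          (pair _ n₁) (pair _ n₂) (beside e₃ i₃ i₄ d₃₄)
      cases (no n₁) (no n₂) (no n₃) =
        three-isolated-in-pairs⇒3≤∣S∣ d₁₂ d₁₃ d₂₃ i₁ i₂ i₃
          (pair _ n₁) (pair _ n₂) (pair _ n₃)

  RP-split : IsRP G → 2 ≤ n → 2 ≤ m → (a : Vec ℕ m) → (∀ i → 1 ≤ lookup a i) → Vec.sum a ≡ n →
             RPPartition a
  RP-split (rp-K1 ∣⊤∣≡1) 2≤n _ _ _ _ =
    contradiction (subst (2 ≤_) (trans (sym (∣⊤∣≡n _)) ∣⊤∣≡1) 2≤n) 1+n≰n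
  RP-split (rp-rec _ _ split) _ 2≤m a a≥1 Σa≡n with split _ 2≤m a a≥1 (trans Σa≡n (sym (∣⊤∣≡n _)))
  ... | P , partitions , sizes , rps =
    record { part = P ; partitions = partitions ; ∣part∣≡ = sizes ; RP-part = rps }

  module Separation (S : Subset n) {k} (Q : Fin k → Subset n) (Q-partition : IsPartitionOf G (∁ S) k Q)
                    (Q-separated : ∀ i j {u v} → i ≢ j → u ∈ Q i → v ∈ Q j → ¬ Adj G u v) where

    component-of : x ∉ S → ∃ λ c → x ∈ Q c
    component-of x∉S = proj₂ (proj₂ Q-partition) (x∉p⇒x∈∁p x∉S)

    walk-avoiding-S-stays : ∀ {c} → WalkIn G A x y → (∀ {w} → w ∈ A → w ∉ S) → x ∈ Q c → y ∈ Q c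
    walk-avoiding-S-stays (here _) _ x∈Qc = x∈Qc
    walk-avoiding-S-stays {c = c} (step _ x~w walk) avoids x∈Qc
      with component-of (avoids (WalkIn-start walk))
    ... | c′ , w∈Qc′ with c Fin.≟ c′
    ...   | yes refl = walk-avoiding-S-stays walk avoids w∈Qc′
    ...   | no  c≢c′ = contradiction x~w (Q-separated c c′ c≢c′ x∈Qc w∈Qc′)

    large-connected⇒Meets : ∀ {L} → ConnectedIn G A → (∀ c → ∣ Q c ∣ ≤ L) → L < ∣ A ∣ → Meets A S
    large-connected⇒Meets {A = A} connected ∣Q∣≤L L<∣A∣ with any? (λ s → s ∈? A ×-dec s ∈? S)
    ... | yes meets = meets
    ... | no  avoids with 0<∣p∣⇒Nonempty (<-≤-trans (s≤s z≤n) L<∣A∣)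
    ...   | x , x∈A with component-of (λ x∈S → avoids (x , x∈A , x∈S))
    ...     | c , x∈Qc = contradiction (<-≤-trans L<∣A∣ (≤-trans (p⊆q⇒∣p∣≤∣q∣ A⊆Qc) (∣Q∣≤L c))) 1+n≰n
      where
      A⊆Qc : A ⊆ Q c
      A⊆Qc y∈A = walk-avoiding-S-stays (connected x∈A y∈A) (λ w∈A w∈S → avoids (_ , w∈A , w∈S)) x∈Qc

    singleton⇒isolated : ∀ {c} → ∣ Q c ∣ ≡ 1 → u ∈ Q c → IsolatedIn∁ S u
    singleton⇒isolated {u = u} {c} ∣Qc∣≡1 u∈Qc = x∈∁p⇒x∉p (proj₁ Q-partition c u∈Qc) , N[u]⊆S
      where
      N[u]⊆S : Adj G u w → w ∈ S
      N[u]⊆S {w} u~w with w ∈? S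
      ... | yes w∈S = w∈S
      ... | no  w∉S with component-of w∉S
      ...   | c′ , w∈Qc′ with c Fin.≟ c′
      ...     | yes refl =
        contradiction (subst (Adj G u) (sym (∣p∣≤1⇒x≡y (≤-reflexive ∣Qc∣≡1) u∈Qc w∈Qc′)) u~w) (irrefl G)
      ...     | no  c≢c′ = contradiction u~w (Q-separated c c′ c≢c′ u∈Qc w∈Qc′)

module FiveComponents {n} (G : Graph n) (rp : IsRP G) (S : Subset n) (∣S∣≡2 : ∣ S ∣ ≡ 2)
  (Q : Fin 5 → Subset n) (Q-partition : IsPartitionOf G (∁ S) 5 Q) (Q-nonempty : ∀ c → Nonempty (Q c))
  (Q-separated : ∀ i j {u v} → i ≢ j → u ∈ Q i → v ∈ Q j → ¬ Adj G u v) where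

  open Separation G S Q Q-partition Q-separated

  ¬3≤∣S∣ : ¬ 3 ≤ ∣ S ∣
  ¬3≤∣S∣ 3≤∣S∣ = 1+n≰n (subst (3 ≤_) ∣S∣≡2 3≤∣S∣)

  2≤n : 2 ≤ n
  2≤n = subst (_≤ n) ∣S∣≡2 (∣p∣≤n S)

  ∣Q∣ : Fin 5 → ℕ
  ∣Q∣ c = ∣ Q c ∣

  singletons large : List (Fin 5)
  singletons = filter (λ c → ∣Q∣ c ≟ 1) (allFin 5)
  large      = filter (λ c → 3 ≤? ∣Q∣ c) (allFin 5)

  Σ∣Q∣ : ℕ
  Σ∣Q∣ = sum (map ∣Q∣ (allFin 5))

  2+Σ∣Q∣≤n : 2 + Σ∣Q∣ ≤ n
  2+Σ∣Q∣≤n = begin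
    2 + Σ∣Q∣                      ≡⟨ cong (2 +_) (∣⋃∣≡sum Q (proj₁ (proj₂ Q-partition) _ _) (allFin⁺ 5)) ⟨
    2 + ∣ ⋃ (map Q (allFin 5)) ∣  ≤⟨ +-monoʳ-≤ 2 (p⊆q⇒∣p∣≤∣q∣ (⋃⊆ Q (proj₁ Q-partition) (allFin 5))) ⟩
    2 + ∣ ∁ S ∣                   ≡⟨ cong (2 +_) (trans (∣∁p∣≡n∸∣p∣ S) (cong (n ∸_) ∣S∣≡2)) ⟩
    2 + (n ∸ 2)                   ≡⟨ m+[n∸m]≡n 2≤n ⟩
    n                             ∎
    where open ≤-Reasoning

  12+#large≤n+#singletons : 12 + length large ≤ n + length singletons
  12+#large≤n+#singletons = begin
    2 + (10 + length large)        ≤⟨ +-monoʳ-≤ 2 (sum-bound ∣Q∣ Q-positive (allFin 5)) ⟩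
    2 + (Σ∣Q∣ + length singletons) ≡⟨ +-assoc 2 Σ∣Q∣ (length singletons) ⟨
    2 + Σ∣Q∣ + length singletons   ≤⟨ +-monoˡ-≤ (length singletons) 2+Σ∣Q∣≤n ⟩
    n + length singletons          ∎
    where
    open ≤-Reasoning

    Q-positive : ∀ c → 1 ≤ ∣Q∣ c
    Q-positive c = x∈p⇒0<∣p∣ (proj₂ (Q-nonempty c))

  singletons-unique : Unique singletons
  singletons-unique = filter⁺ (λ c → ∣Q∣ c ≟ 1) (allFin⁺ 5)

  singletons-≡1 : All (λ c → ∣ Q c ∣ ≡ 1) singletons
  singletons-≡1 = all-filter (λ c → ∣Q∣ c ≟ 1) (allFin 5)

  vertex : Fin 5 → Fin n
  vertex c = proj₁ (Q-nonempty c)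

  vertex-isolated : ∀ {c} → ∣ Q c ∣ ≡ 1 → IsolatedIn∁ G S (vertex c)
  vertex-isolated ∣Qc∣≡1 = singleton⇒isolated ∣Qc∣≡1 (proj₂ (Q-nonempty _))

  vertex-injective : ∀ {c c′} → c ≢ c′ → vertex c ≢ vertex c′
  vertex-injective {c} {c′} c≢c′ eq =
    proj₁ (proj₂ Q-partition) c c′ c≢c′ (proj₂ (Q-nonempty c))
          (subst (_∈ Q c′) (sym eq) (proj₂ (Q-nonempty c′)))

  four-singletons⇒⊥ : ∀ {cs} → Unique cs → All (λ c → ∣ Q c ∣ ≡ 1) cs → 4 ≤ length cs → ⊥
  four-singletons⇒⊥ {[]}                  _ _ ()
  four-singletons⇒⊥ {_ ∷ []}              _ _ (s≤s ())
  four-singletons⇒⊥ {_ ∷ _ ∷ []}          _ _ (s≤s (s≤s ()))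
  four-singletons⇒⊥ {_ ∷ _ ∷ _ ∷ []}      _ _ (s≤s (s≤s (s≤s ())))
  four-singletons⇒⊥ {c₁ ∷ c₂ ∷ c₃ ∷ c₄ ∷ _}
    ((d₁₂ ∷ d₁₃ ∷ d₁₄ ∷ _) ∷ (d₂₃ ∷ d₂₄ ∷ _) ∷ (d₃₄ ∷ _) ∷ _) (s₁ ∷ s₂ ∷ s₃ ∷ s₄ ∷ _) _ =
    ¬3≤∣S∣ (four-isolated⇒3≤∣S∣ ∣part∣≤2 pairs
      (vertex-injective d₁₂) (vertex-injective d₁₃) (vertex-injective d₁₄)
      (vertex-injective d₂₃) (vertex-injective d₂₄) (vertex-injective d₃₄)
      (vertex-isolated s₁) (vertex-isolated s₂) (vertex-isolated s₃) (vertex-isolated s₄))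
    where
    3≤n : 3 ≤ n
    3≤n = subst (3 ≤_) (∣⊤∣≡n n)
      (distinct₃⇒3≤∣p∣ ∈⊤ ∈⊤ ∈⊤ (vertex-injective d₁₂) (vertex-injective d₁₃) (vertex-injective d₂₃))

    open RPPartition (RP-split G rp 2≤n (near-pairing-length 3≤n) (near-pairing n)
                               (near-pairing-positive n) (near-pairing-sum (≤-trans (s≤s z≤n) 3≤n)))

    ∣part∣≤2 : ∀ i → ∣ part i ∣ ≤ 2
    ∣part∣≤2 i = ≤-trans (≤-reflexive (∣part∣≡ i)) (near-pairing-≤2 n i)

    pairs : ∀ i → i ≢ zero → ∣ part i ∣ ≡ 2
    pairs i i≢0 = trans (∣part∣≡ i) (near-pairing-≡2 n i i≢0)

  even∧three-singletons⇒⊥ : ∀ k → 2 ≤ k → k * 2 ≡ n →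
                            ∀ {cs} → Unique cs → All (λ c → ∣ Q c ∣ ≡ 1) cs → 3 ≤ length cs → ⊥
  even∧three-singletons⇒⊥ _ _ _ {[]}         _ _ ()
  even∧three-singletons⇒⊥ _ _ _ {_ ∷ []}     _ _ (s≤s ())
  even∧three-singletons⇒⊥ _ _ _ {_ ∷ _ ∷ []} _ _ (s≤s (s≤s ()))
  even∧three-singletons⇒⊥ k 2≤k k*2≡n {c₁ ∷ c₂ ∷ c₃ ∷ _}
    ((d₁₂ ∷ d₁₃ ∷ _) ∷ (d₂₃ ∷ _) ∷ _) (s₁ ∷ s₂ ∷ s₃ ∷ _) _ =
    ¬3≤∣S∣ (three-isolated-in-pairs⇒3≤∣S∣
      (vertex-injective d₁₂) (vertex-injective d₁₃) (vertex-injective d₂₃)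
      (vertex-isolated s₁) (vertex-isolated s₂) (vertex-isolated s₃) (pair _) (pair _) (pair _))
    where
    open RPPartition (RP-split G rp 2≤n 2≤k (replicate k 2)
                        (λ i → ≤-trans (s≤s z≤n) (≤-reflexive (sym (lookup-replicate i 2))))
                        (trans (sum-replicate k 2) k*2≡n))

    pair : ∀ i → ∣ part i ∣ ≡ 2
    pair i = trans (∣part∣≡ i) (lookup-replicate i 2)

  small-components⇒⊥ : (∀ c → ∣ Q c ∣ ≤ 2) → 9 ≤ n → ⊥
  small-components⇒⊥ small 9≤n =
    ¬3≤∣S∣ (three-Meets⇒3≤∣S∣ {i = zero} {suc zero} {suc (suc zero)} (λ ()) (λ ()) (λ ())
                               (meets _) (meets _) (meets _))
    where
    sizes : Vec ℕ 3
    sizes = 3 ∷ 3 ∷ n ∸ 6 ∷ []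

    3≤sizes : ∀ i → 3 ≤ lookup sizes i
    3≤sizes zero             = ≤-refl
    3≤sizes (suc zero)       = ≤-refl
    3≤sizes (suc (suc zero)) = ∸-monoˡ-≤ 6 9≤n

    Σsizes≡n : Vec.sum sizes ≡ n
    Σsizes≡n = trans (cong (6 +_) (+-identityʳ (n ∸ 6))) (m+[n∸m]≡n (≤-trans (m≤m+n 6 3) 9≤n))

    open RPPartition (RP-split G rp 2≤n (s≤s (s≤s z≤n)) sizes (λ i → ≤-trans (s≤s z≤n) (3≤sizes i))
                               Σsizes≡n)

    meets : ∀ i → Meets (part i) S
    meets i = large-connected⇒Meets connected small 3≤∣part∣
      where
      3≤∣part∣ : 3 ≤ ∣ part i ∣
      3≤∣part∣ = subst (3 ≤_) (sym (∣part∣≡ i)) (3≤sizes i)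

      connected : ConnectedIn G (part i)
      connected = RP⇒ConnectedIn G (RP-part i) (≤-trans (s≤s (s≤s z≤n)) 3≤∣part∣)

  12≤n+#singletons : 12 ≤ n + length singletons
  12≤n+#singletons = ≤-trans (m≤m+n 12 (length large)) 12+#large≤n+#singletons

  13≤n+#singletons : ¬ (∀ c → ∣ Q c ∣ ≤ 2) → 13 ≤ n + length singletons
  13≤n+#singletons ¬small with ¬∀⟶∃¬ 5 _ (λ c → ∣Q∣ c ≤? 2) ¬small
  ... | c , ∣Qc∣≰2 = ≤-trans (+-monoʳ-≤ 12 large≢[]) 12+#large≤n+#singletons
    where
    large≢[] : 1 ≤ length large
    large≢[] = filter-some (λ c → 3 ≤? ∣Q∣ c) (lose (∈-allFin c) (≰⇒> ∣Qc∣≰2))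

  n≤10⇒⊥ : n ≤ 10 → ⊥
  n≤10⇒⊥ n≤10 with all? (λ c → ∣Q∣ c ≤? 2)
  ... | yes small with 9 ≤? n
  ...   | yes 9≤n = small-components⇒⊥ small 9≤n
  ...   | no  9≰n = four-singletons⇒⊥ singletons-unique singletons-≡1
                      (m+k≤n+t⇒k≤t 12≤n+#singletons (≤-pred (≰⇒> 9≰n)))
  n≤10⇒⊥ n≤10 | no ¬small with n ≟ 10
  ... | yes n≡10 = even∧three-singletons⇒⊥ 5 (s≤s (s≤s z≤n)) (sym n≡10) singletons-unique singletons-≡1
                     (m+k≤n+t⇒k≤t (13≤n+#singletons ¬small) n≤10)
  ... | no  n≢10 = four-singletons⇒⊥ singletons-unique singletons-≡1
                     (m+k≤n+t⇒k≤t (13≤n+#singletons ¬small) (≤-pred (≤∧≢⇒< n≤10 n≢10)))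

corollary32 : (n : ℕ) (G : Graph n) → IsRP G →
    (S : Subset n) → ∣ S ∣ ≡ 2 → NumComponents G (∁ S) 5 →
    11 ≤ n
corollary32 n G rp S ∣S∣≡2 (Q , Q-partition , Q-nonempty , _ , Q-separated) =
  ≮⇒≥ λ n<11 → FiveComponents.n≤10⇒⊥ G rp S ∣S∣≡2 Q Q-partition Q-nonempty Q-separated (≤-pred n<11)
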